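{- Let $1\neq K\leq\mathrm{Aut}(Q_n)$. If $d_K\geq 3$, then $(Q_n)_K$ has a cycle of length $d_K$.
   Context: The $n$-cube $Q_n$ has vertex set $\mathbb{F}_2^n$, two vectors adjacent iff their Hamming distance is $1$; $\mathrm{Aut}(Q_n)=\mathbb{F}_2^n: S_n$. For $K\leq\mathrm{Aut}(Q_n)$, $d_K:=\min\{d_{Q_n}(x,x^k): x\in\mathbb{F}_2^n,\ 1\neq k\in K\}$ if $K\neq 1$ and $d_K:=\infty$ if $K=1$. The normal quotient $(Q_n)_K$ is the simple graph whose vertices are the $K$-orbits on $\mathbb{F}_2^n$, distinct orbits adjacent iff some vertex of one is adjacent in $Q_n$ to some vertex of the other. -}

module Defs where

open import Data.Nat using (ℕ; zero; suc; _+_; _≤_; _<_)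
open import Data.Bool using (Bool; true; false; _xor_; if_then_else_)
open import Data.Fin using (Fin)
open import Data.Vec using (Vec; []; _∷_; lookup; tabulate; replicate; allFin)
open import Data.Product using (_×_; _,_; ∃; ∃-syntax; Σ-syntax)
open import Relation.Binary.PropositionalEquality using (_≡_; _≢_)
open import Relation.Nullary using (¬_)

-- Vertices of Q_n : vectors in F_2^n (F_2 = Bool, addition = xor).
Vertex : ℕ → Set
Vertex n = Vec Bool n

-- Hamming distance; this is the graph distance d_{Q_n}.
hamming : ∀ {n} → Vertex n → Vertex n → ℕ
hamming [] [] = 0
hamming (a ∷ x) (b ∷ y) = (if a xor b then 1 else 0) + hamming x y

AdjQ : ∀ {n} → Vertex n → Vertex n → Set
AdjQ x y = hamming x y ≡ 1

-- Candidate elements of Aut(Q_n) = F_2^n : S_n : a pair (v , σ) with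
-- v ∈ F_2^n and σ a map Fin n → Fin n given as a table; it is an actual
-- automorphism iff σ is a permutation (IsAut).
AutC : ℕ → Set
AutC n = Vec Bool n × Vec (Fin n) n

IsAut : ∀ {n} → AutC n → Set
IsAut (v , σ) = ∀ i j → lookup σ i ≡ lookup σ j → i ≡ j

act : ∀ {n} → AutC n → Vertex n → Vertex n
act (v , σ) x = tabulate (λ i → lookup x (lookup σ i) xor lookup v i)

-- Group product:  act (g · h) = act g ∘ act h.
_·_ : ∀ {n} → AutC n → AutC n → AutC n
(vg , σg) · (vh , σh) =
  tabulate (λ i → lookup vh (lookup σg i) xor lookup vg i) ,
  tabulate (λ i → lookup σh (lookup σg i))

idAut : ∀ {n} → AutC n
idAut {n} = replicate n false , allFin n

record IsSubgroup {n : ℕ} (K : AutC n → Set) : Set where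
  field
    inAut   : ∀ g → K g → IsAut g
    hasId   : K idAut
    closed  : ∀ g h → K g → K h → K (g · h)
    hasInv  : ∀ g → K g → ∃[ h ] (K h × g · h ≡ idAut × h · g ≡ idAut)

IsDK : ∀ {n} → (K : AutC n → Set) → ℕ → Set
IsDK {n} K d =
  (∃[ x ] ∃[ k ] (K k × k ≢ idAut × hamming x (act k x) ≡ d)) ×
  (∀ (x : Vertex n) k → K k → k ≢ idAut → d ≤ hamming x (act k x))

InOrbit : ∀ {n} → (AutC n → Set) → Vertex n → Vertex n → Set
InOrbit K x y = ∃[ k ] (K k × act k x ≡ y)

AdjQuot : ∀ {n} → (AutC n → Set) → Vertex n → Vertex n → Set
AdjQuot K x y =
  ¬ InOrbit K x y × ∃[ a ] ∃[ b ] (InOrbit K x a × InOrbit K y b × AdjQ a b)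

HasCycle : ∀ {n} → (AutC n → Set) → ℕ → Set
HasCycle {n} K m =
  Σ[ c ∈ (ℕ → Vertex n) ]
    ((∀ i j → i < j → j < m → ¬ InOrbit K (c i) (c j)) ×
     (∀ i → i < m → AdjQuot K (c i) (c (suc i))) ×
     c m ≡ c 0)

module Submission where

open import Defs
open import Data.Nat using (ℕ; _≤_)
open import Data.Product using (_×_; ∃-syntax)
open import Relation.Binary.PropositionalEquality using (_≢_)

open import Data.Nat using (zero; suc; _<_; _∸_; _≟_; z≤n; s≤s)
open import Data.Nat.Properties
  using (≤-refl; n≤1+n; m≤n⇒m≤1+n; <-irrefl; ≤-<-trans; <-trans; <⇒≤; ≤∧≢⇒<; m∸n≤m; m<n⇒0<n∸m; m+n∸n≡m)
open import Data.Bool using (false; true; _xor_)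
open import Data.Bool.Properties using (xor-identityʳ)
open import Data.Vec using (_∷_; []; lookup)
open import Data.Vec.Properties using (lookup-replicate; lookup-allFin; tabulate∘lookup; tabulate-cong)
open import Data.Product using (_,_)
open import Data.Empty using (⊥-elim)
open import Relation.Nullary using (¬_; yes; no)
open import Relation.Binary.PropositionalEquality using (_≡_; refl; sym; trans; cong; cong₂; subst)

-- Choose x and 1 ≠ k ∈ K with d(x, x^k) = d_K and walk along a geodesic
-- x = p₀, p₁, …, p_d = x^k in Q_n. Any two of p₀, …, p_{d-1} are at distance strictly
-- between 0 and d_K, so no element of K maps one to the other: their orbits are
-- distinct. Consecutive p_i are adjacent, and p_{d-1} is adjacent to x^k, which lies
-- in the orbit of p₀ = x; so the orbits of p₀, …, p_{d-1} form a d-cycle in (Q_n)_K.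

hamming-self : ∀ {n} (x : Vertex n) → hamming x x ≡ 0
hamming-self [] = refl
hamming-self (false ∷ x) = hamming-self x
hamming-self (true ∷ x) = hamming-self x

hamming-sym : ∀ {n} (x y : Vertex n) → hamming x y ≡ hamming y x
hamming-sym [] [] = refl
hamming-sym (false ∷ x) (false ∷ y) = hamming-sym x y
hamming-sym (true ∷ x) (true ∷ y) = hamming-sym x y
hamming-sym (false ∷ x) (true ∷ y) = cong suc (hamming-sym x y)
hamming-sym (true ∷ x) (false ∷ y) = cong suc (hamming-sym x y)

-- geodesic i x y agrees with y on the first i coordinates where x and y differ, and with x elsewhere.
geodesic : ∀ {n} → ℕ → Vertex n → Vertex n → Vertex n
geodesic i [] [] = []
geodesic i (false ∷ x) (false ∷ y) = false ∷ geodesic i x y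
geodesic i (true ∷ x) (true ∷ y) = true ∷ geodesic i x y
geodesic zero (a ∷ x) (_ ∷ y) = a ∷ geodesic zero x y
geodesic (suc i) (false ∷ x) (true ∷ y) = true ∷ geodesic i x y
geodesic (suc i) (true ∷ x) (false ∷ y) = false ∷ geodesic i x y

geodesic-start : ∀ {n} (x y : Vertex n) → geodesic 0 x y ≡ x
geodesic-start [] [] = refl
geodesic-start (false ∷ x) (false ∷ y) = cong (false ∷_) (geodesic-start x y)
geodesic-start (true ∷ x) (true ∷ y) = cong (true ∷_) (geodesic-start x y)
geodesic-start (false ∷ x) (true ∷ y) = cong (false ∷_) (geodesic-start x y)
geodesic-start (true ∷ x) (false ∷ y) = cong (true ∷_) (geodesic-start x y)

geodesic-end : ∀ {n} (x y : Vertex n) → geodesic (hamming x y) x y ≡ y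
geodesic-end [] [] = refl
geodesic-end (false ∷ x) (false ∷ y) = cong (false ∷_) (geodesic-end x y)
geodesic-end (true ∷ x) (true ∷ y) = cong (true ∷_) (geodesic-end x y)
geodesic-end (false ∷ x) (true ∷ y) = cong (true ∷_) (geodesic-end x y)
geodesic-end (true ∷ x) (false ∷ y) = cong (false ∷_) (geodesic-end x y)

hamming-geodesic : ∀ {n} (x y : Vertex n) {i j} → i ≤ j → j ≤ hamming x y →
  hamming (geodesic i x y) (geodesic j x y) ≡ j ∸ i
hamming-geodesic [] [] z≤n z≤n = refl
hamming-geodesic (false ∷ x) (false ∷ y) i≤j j≤h = hamming-geodesic x y i≤j j≤h
hamming-geodesic (true ∷ x) (true ∷ y) i≤j j≤h = hamming-geodesic x y i≤j j≤h
hamming-geodesic (false ∷ x) (true ∷ y) {zero} {zero} _ _ = hamming-geodesic x y z≤n z≤n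
hamming-geodesic (false ∷ x) (true ∷ y) {zero} {suc j} _ (s≤s j≤h) =
  cong suc (hamming-geodesic x y z≤n j≤h)
hamming-geodesic (false ∷ x) (true ∷ y) {suc i} {suc j} (s≤s i≤j) (s≤s j≤h) =
  hamming-geodesic x y i≤j j≤h
hamming-geodesic (true ∷ x) (false ∷ y) {zero} {zero} _ _ = hamming-geodesic x y z≤n z≤n
hamming-geodesic (true ∷ x) (false ∷ y) {zero} {suc j} _ (s≤s j≤h) =
  cong suc (hamming-geodesic x y z≤n j≤h)
hamming-geodesic (true ∷ x) (false ∷ y) {suc i} {suc j} (s≤s i≤j) (s≤s j≤h) =
  hamming-geodesic x y i≤j j≤h

geodesic-adjacent : ∀ {n} (x y : Vertex n) {i} → suc i ≤ hamming x y →
  AdjQ (geodesic i x y) (geodesic (suc i) x y)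
geodesic-adjacent x y {i} i<h = trans (hamming-geodesic x y (n≤1+n i) i<h) (m+n∸n≡m 1 i)

act-idAut : ∀ {n} (x : Vertex n) → act idAut x ≡ x
act-idAut x = trans
  (tabulate-cong λ i → trans
    (cong₂ _xor_ (cong (lookup x) (lookup-allFin i)) (lookup-replicate i false))
    (xor-identityʳ (lookup x i)))
  (tabulate∘lookup x)

InOrbit-refl : ∀ {n} {K : AutC n → Set} → IsSubgroup K → (x : Vertex n) → InOrbit K x x
InOrbit-refl K≤Aut x = idAut , IsSubgroup.hasId K≤Aut , act-idAut x

near-¬InOrbit : ∀ {n} {K : AutC n → Set} {d} →
  (∀ (x : Vertex n) k → K k → k ≢ idAut → d ≤ hamming x (act k x)) →
  ∀ u v → 0 < hamming u v → hamming u v < d → ¬ InOrbit K u v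
near-¬InOrbit displacement u v 0<h h<d (g , g∈K , gu≡v) =
  <-irrefl refl (≤-<-trans (subst (_ ≤_) (cong (hamming u) gu≡v) (displacement u g g∈K g≢1)) h<d)
  where
  g≢1 : g ≢ idAut
  g≢1 refl = <-irrefl (sym h≡0) 0<h
    where
    h≡0 : hamming u v ≡ 0
    h≡0 = trans (cong (hamming u) (trans (sym gu≡v) (act-idAut u))) (hamming-self u)

AdjQ⇒AdjQuot : ∀ {n} {K : AutC n → Set} → IsSubgroup K → ∀ x y →
  ¬ InOrbit K x y → AdjQ x y → AdjQuot K x y
AdjQ⇒AdjQuot K≤Aut x y x≁y x~y = x≁y , x , y , InOrbit-refl K≤Aut x , InOrbit-refl K≤Aut y , x~y

close-path : ∀ {n} {K : AutC n → Set} l (p : ℕ → Vertex n) →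
  (∀ i j → i < j → j < suc l → ¬ InOrbit K (p i) (p j)) →
  (∀ i → i < l → AdjQuot K (p i) (p (suc i))) →
  AdjQuot K (p l) (p 0) →
  HasCycle K (suc l)
close-path {n} {K} l p apart step back = c , apart′ , step′ , c-end
  where
  c : ℕ → Vertex n
  c i with i ≟ suc l
  ... | yes _ = p 0
  ... | no _ = p i

  c-path : ∀ i → i < suc l → c i ≡ p i
  c-path i i<m with i ≟ suc l
  ... | yes i≡m = ⊥-elim (<-irrefl i≡m i<m)
  ... | no _ = refl

  c-end : c (suc l) ≡ c 0
  c-end with suc l ≟ suc l
  ... | yes _ = refl
  ... | no m≢m = ⊥-elim (m≢m refl)

  apart′ : ∀ i j → i < j → j < suc l → ¬ InOrbit K (c i) (c j)
  apart′ i j i<j j<m rewrite c-path i (<-trans i<j j<m) | c-path j j<m = apart i j i<j j<m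

  step′ : ∀ i → i < suc l → AdjQuot K (c i) (c (suc i))
  step′ i (s≤s i≤l) with i ≟ l
  ... | yes refl rewrite c-path i (s≤s i≤l) | c-end = back
  ... | no i≢l rewrite c-path i (s≤s i≤l) | c-path (suc i) (s≤s (≤∧≢⇒< i≤l i≢l)) =
        step i (≤∧≢⇒< i≤l i≢l)

lemma3p3 : (n : ℕ) (K : AutC n → Set) → IsSubgroup K →
    (∃[ k ] (K k × k ≢ idAut)) →
    (d : ℕ) → IsDK K d → 3 ≤ d → HasCycle K d
-- K ≠ 1 already follows from IsDK, and of 3 ≤ d only 2 ≤ d is needed (for p_{d-1} ≠ p₀).
lemma3p3 n K K≤Aut _ (suc l) ((x , k , k∈K , _ , h≡d) , displacement) (s≤s 1<l) =
  close-path l p apart step back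
  where
  y = act k x
  p : ℕ → Vertex n
  p i = geodesic i x y

  bounded : ∀ {j} → j ≤ suc l → j ≤ hamming x y
  bounded = subst (_ ≤_) (sym h≡d)

  apart : ∀ i j → i < j → j < suc l → ¬ InOrbit K (p i) (p j)
  apart i j i<j j<m = near-¬InOrbit displacement (p i) (p j)
      (subst (0 <_) (sym distance) (m<n⇒0<n∸m i<j))
      (subst (_< suc l) (sym distance) (≤-<-trans (m∸n≤m j i) j<m))
    where
    distance : hamming (p i) (p j) ≡ j ∸ i
    distance = hamming-geodesic x y (<⇒≤ i<j) (bounded (<⇒≤ j<m))

  step : ∀ i → i < l → AdjQuot K (p i) (p (suc i))
  step i i<l = AdjQ⇒AdjQuot K≤Aut (p i) (p (suc i)) (apart i (suc i) ≤-refl (s≤s i<l))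
    (geodesic-adjacent x y (bounded (m≤n⇒m≤1+n i<l)))

  p-end : p (suc l) ≡ y
  p-end = trans (cong (λ m → geodesic m x y) (sym h≡d)) (geodesic-end x y)

  back-distance : hamming (p l) (p 0) ≡ l
  back-distance = trans (hamming-sym (p l) (p 0)) (hamming-geodesic x y z≤n (bounded (n≤1+n l)))

  back : AdjQuot K (p l) (p 0)
  back =
    near-¬InOrbit displacement (p l) (p 0)
      (subst (0 <_) (sym back-distance) (<-trans (s≤s z≤n) 1<l))
      (subst (_< suc l) (sym back-distance) ≤-refl) ,
    p l , y , InOrbit-refl K≤Aut (p l) , (k , k∈K , cong (act k) (geodesic-start x y)) ,
    subst (AdjQ (p l)) p-end (geodesic-adjacent x y (bounded ≤-refl))
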